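{- For all positive integers $m,n$: (i) $C(m,n)=C(n,m)$; (ii) $C(m,n)=C(m+n,n)$.
   Context: The $m\times n$ plane grid has point set $\{0,1,\dots,m\}\times\{0,1,\dots,n\}\subset\mathbb{Z}^2$; it has $2mn$ unit diagonals (two per unit square). The boundary of $[0,m]\times[0,n]$ consists of mirrors. A beam of light travels along unit diagonals from grid point to grid point: at each step each coordinate changes by $\pm1$, and a coordinate reverses its direction of change exactly when it reaches $0$ or its maximum value. The trajectories partition the set of unit diagonals. A trajectory passing through a corner of the rectangle (running from one corner to another) is an open path; every other trajectory is periodic and is called a closed path. $C(m,n)$ denotes the number of closed paths in the $m\times n$ grid. -}

module Defs where

open import Data.Bool using (Bool; true; false; if_then_else_; _∧_; _∨_; not)
open import Data.Nat using (ℕ; zero; suc; _+_; _*_; _∸_; _⊓_; _≡ᵇ_)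
open import Data.List using (List; []; _∷_; concatMap; upTo)
open import Data.Bool.ListAction using (any)

-- Billiard dynamics on the m × n grid {0..m} × {0..n}.
-- Direction of a coordinate: true = increasing (+1), false = decreasing (-1).

record State : Set where
  constructor st
  field
    x  : ℕ
    y  : ℕ
    dx : Bool
    dy : Bool

-- A unit diagonal: lower-left corner (i , j) of its unit square (i < m, j < n),
-- and main = true for the diagonal (i,j)-(i+1,j+1), false for (i+1,j)-(i,j+1).
record Diag : Set where
  constructor dg
  field
    i    : ℕ
    j    : ℕ
    main : Bool

mv : Bool → ℕ → ℕ
mv true  a = suc a
mv false a = a ∸ 1

newDir : ℕ → ℕ → Bool → Bool
newDir M a d = if a ≡ᵇ 0 then true else (if a ≡ᵇ M then false else d)

step : ℕ → ℕ → State → State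
step m n (st x y dx dy) =
  st (mv dx x) (mv dy y) (newDir m (mv dx x) dx) (newDir n (mv dy y) dy)

iter : ℕ → (State → State) → State → State
iter zero    f s = s
iter (suc k) f s = iter k f (f s)

_==ᵇ_ : Bool → Bool → Bool
true  ==ᵇ b = b
false ==ᵇ b = not b

diagOf : State → Diag
diagOf (st x y dx dy) = dg (x ⊓ mv dx x) (y ⊓ mv dy y) (dx ==ᵇ dy)

_=ᴰ_ : Diag → Diag → Bool
dg i j b =ᴰ dg i' j' b' = (i ≡ᵇ i') ∧ ((j ≡ᵇ j') ∧ (b ==ᵇ b'))

startFwd : Diag → State
startFwd (dg i j true)  = st i j true true
startFwd (dg i j false) = st (suc i) j false true

startBwd : Diag → State
startBwd (dg i j true)  = st (suc i) (suc j) false false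
startBwd (dg i j false) = st i (suc j) true false

-- number of states; every orbit of the (bijective) step map has period ≤ this
bound : ℕ → ℕ → ℕ
bound m n = 4 * (suc m * suc n)

orbit : ℕ → ℕ → State → List State
orbit m n s = Data.List.map (λ k → iter k (step m n) s) (upTo (bound m n))

trajStates : ℕ → ℕ → Diag → List State
trajStates m n d = orbit m n (startFwd d) Data.List.++ orbit m n (startBwd d)

sameTraj : ℕ → ℕ → Diag → Diag → Bool
sameTraj m n d e = any (λ s → diagOf s =ᴰ e) (trajStates m n d)

isCorner : ℕ → ℕ → State → Bool
isCorner m n (st x y _ _) = ((x ≡ᵇ 0) ∨ (x ≡ᵇ m)) ∧ ((y ≡ᵇ 0) ∨ (y ≡ᵇ n))

isOpen : ℕ → ℕ → Diag → Bool
isOpen m n d = any (isCorner m n) (trajStates m n d)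

diags : ℕ → ℕ → List Diag
diags m n = concatMap (λ i → concatMap (λ j → dg i j true ∷ dg i j false ∷ []) (upTo n)) (upTo m)

-- count the trajectories (equivalence classes) of the closed diagonals:
-- a diagonal is counted iff it is closed and no earlier diagonal lies on its trajectory
countClasses : ℕ → ℕ → List Diag → List Diag → ℕ
countClasses m n seen [] = 0
countClasses m n seen (d ∷ ds) =
  (if not (isOpen m n d) ∧ not (any (sameTraj m n d) seen) then 1 else 0)
  + countClasses m n (d ∷ seen) ds

C : ℕ → ℕ → ℕ
C m n = countClasses m n [] (diags m n)

-- Unfolding the mirrors, a coordinate bouncing in [0, M] is the image of a point moving
-- uniformly around ℤ/2M, so the beam becomes the translation (a, b) ↦ (a + 1, b + 1) of
-- ℤ/2m × ℤ/2n. By the Chinese remainder theorem two unfolded points lie on one orbit iff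
-- their differences a − b agree modulo gcd(2m, 2n) = 2g, where g = gcd(m, n), and an orbit
-- passes through a corner iff a ≡ b (mod g). A unit diagonal is crossed by two unfolded
-- points, one per direction, with differences t and −t, so min(t, −t) ∈ [0, g] labels its
-- trajectory, which is open iff the label is 0 or g. Every label 1, …, g − 1 occurs (the
-- diagonal from (k, 0) to (k + 1, 1) has label k), hence C(m, n) = gcd(m, n) − 1, which is
-- symmetric and invariant under (m, n) ↦ (m + n, n).
module Submission where

open import Defs
open import Data.Nat using (ℕ; _+_; _≤_)
open import Data.Product using (_×_)
open import Relation.Binary.PropositionalEquality using (_≡_)
open import Data.Nat
open import Data.Nat.Properties
open import Data.Nat.DivMod
open import Data.Nat.Divisibility using (_∣_; ∣-refl; m%n≡0⇒n∣m; n∣m⇒m%n≡0; ∣⇒≤; m∣m*n; n∣m*n)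
open import Data.Nat.GCD using (GCD; module Bézout; gcd; gcd-GCD; gcd-comm; gcd[m,n]≢0; c*gcd[m,n]≡gcd[cm,cn])
open import Data.Product using (_,_; proj₁; proj₂; ∃-syntax)
open import Data.Bool using (Bool; true; false; if_then_else_; _∧_; _∨_; not; T)
open import Data.Sum using (_⊎_; inj₁; inj₂; [_,_])
import Data.Sum
open import Data.List using (List; []; _∷_; _++_; upTo)
open import Data.Bool.ListAction using (any)
open import Data.List.Membership.Propositional using (_∈_; find; lose)
open import Data.List.Membership.Propositional.Properties using (∈-upTo⁺; ∈-upTo⁻; ∈-concatMap⁺; ∈-concatMap⁻)
open import Data.List.Relation.Unary.All using (All; []; _∷_)
import Data.List.Relation.Unary.All as All
open import Data.List.Relation.Unary.Any using (here; there)
open import Data.List.Relation.Unary.Any.Properties using (any⁺; any⁻; map⁺; map⁻; ++⁺ˡ; ++⁺ʳ; ++⁻)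
open import Relation.Binary.PropositionalEquality using (_≢_; refl; sym; trans; cong; cong₂; subst; subst₂; module ≡-Reasoning)
open import Relation.Nullary using (yes; no)
open import Relation.Nullary.Negation using (contradiction)
open import Data.Empty using (⊥-elim)
open import Function.Base using (_∘_)
open import Relation.Nullary.Decidable using (dec-true; dec-false)
open import Relation.Binary.Definitions using (tri<; tri≈; tri>)
open import Function.Bundles using (_⇔_; mk⇔; Equivalence)
open import Function.Properties.Equivalence using () renaming (sym to ⇔-sym; trans to ⇔-trans)

open import Data.Nat.Tactic.RingSolver using (solve-∀)
open import Data.Bool.Properties using (∨-identityʳ; T-∨; T-∧; T-≡)
open import Algebra.Properties.CommutativeSemigroup +-commutativeSemigroup using (xy∙z≈xz∙y; x∙yz≈y∙xz)

open ≡-Reasoning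

infix 4 _≡_[mod_]
_≡_[mod_] : ℕ → ℕ → (N : ℕ) → .{{NonZero N}} → Set
x ≡ y [mod N ] = x % N ≡ y % N

0%n≡0 : ∀ n .{{_ : NonZero n}} → 0 % n ≡ 0
0%n≡0 n = m<n⇒m%n≡m (>-nonZero⁻¹ n)

module _ (N : ℕ) .{{_ : NonZero N}} where

  [m%n+k]%n≡[m+k]%n : ∀ m k → m % N + k ≡ m + k [mod N ]
  [m%n+k]%n≡[m+k]%n m k = begin
    (m % N + k) % N          ≡⟨ %-distribˡ-+ (m % N) k N ⟩
    (m % N % N + k % N) % N  ≡⟨ cong (λ r → (r + k % N) % N) (m%n%n≡m%n m N) ⟩
    (m % N + k % N) % N      ≡⟨ %-distribˡ-+ m k N ⟨
    (m + k) % N              ∎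

  n∣m+[n∸m%n] : ∀ m → N ∣ m + (N ∸ m % N)
  n∣m+[n∸m%n] m = m%n≡0⇒n∣m _ N (begin
    (m + (N ∸ m % N)) % N      ≡⟨ [m%n+k]%n≡[m+k]%n m (N ∸ m % N) ⟨
    (m % N + (N ∸ m % N)) % N  ≡⟨ %-congˡ (m+[n∸m]≡n (m%n≤n m N)) ⟩
    N % N                      ≡⟨ n%n≡0 N ⟩
    0                          ∎)

  +-congʳ-mod : ∀ {x y} z → x ≡ y [mod N ] → x + z ≡ y + z [mod N ]
  +-congʳ-mod {x} {y} z x≡y = begin
    (x + z) % N      ≡⟨ [m%n+k]%n≡[m+k]%n x z ⟨
    (x % N + z) % N  ≡⟨ cong (λ r → (r + z) % N) x≡y ⟩
    (y % N + z) % N  ≡⟨ [m%n+k]%n≡[m+k]%n y z ⟩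
    (y + z) % N      ∎

  +-congˡ-mod : ∀ {x y} z → x ≡ y [mod N ] → z + x ≡ z + y [mod N ]
  +-congˡ-mod {x} {y} z x≡y = begin
    (z + x) % N  ≡⟨ %-congˡ (+-comm z x) ⟩
    (x + z) % N  ≡⟨ +-congʳ-mod z x≡y ⟩
    (y + z) % N  ≡⟨ %-congˡ (+-comm y z) ⟩
    (z + y) % N  ∎

  +-cancelʳ-mod : ∀ {x y} z → x + z ≡ y + z [mod N ] → x ≡ y [mod N ]
  +-cancelʳ-mod {x} {y} z x+z≡y+z = begin
    x % N              ≡⟨ %-remove-+ʳ x (n∣m+[n∸m%n] z) ⟨
    (x + (z + w)) % N  ≡⟨ %-congˡ (+-assoc x z w) ⟨
    (x + z + w) % N    ≡⟨ +-congʳ-mod w x+z≡y+z ⟩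
    (y + z + w) % N    ≡⟨ %-congˡ (+-assoc y z w) ⟩
    (y + (z + w)) % N  ≡⟨ %-remove-+ʳ y (n∣m+[n∸m%n] z) ⟩
    y % N              ∎
    where w = N ∸ z % N

≡-mod-∣ : ∀ {G N x y} .{{_ : NonZero G}} .{{_ : NonZero N}} → G ∣ N → x ≡ y [mod N ] → x ≡ y [mod G ]
≡-mod-∣ {G} {N} {x} {y} G∣N x≡y = begin
  x % G      ≡⟨ m∣n⇒o%n%m≡o%m G N x G∣N ⟨
  x % N % G  ≡⟨ cong (_% G) x≡y ⟩
  y % N % G  ≡⟨ m∣n⇒o%n%m≡o%m G N y G∣N ⟩
  y % G      ∎

crt-necessary : ∀ {M N G u v p q} k .{{_ : NonZero M}} .{{_ : NonZero N}} .{{_ : NonZero G}} →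
                G ∣ M → G ∣ N → u + k ≡ p [mod M ] → v + k ≡ q [mod N ] → u + q ≡ v + p [mod G ]
crt-necessary {M} {N} {G} {u} {v} {p} {q} k G∣M G∣N u+k≡p v+k≡q = +-cancelʳ-mod G k (begin
  (u + q + k) % G  ≡⟨ %-congˡ (xy∙z≈xz∙y u q k) ⟩
  (u + k + q) % G  ≡⟨ +-congʳ-mod G q (≡-mod-∣ G∣M u+k≡p) ⟩
  (p + q) % G      ≡⟨ %-congˡ (+-comm p q) ⟩
  (q + p) % G      ≡⟨ +-congʳ-mod G p (≡-mod-∣ G∣N v+k≡q) ⟨
  (v + k + p) % G  ≡⟨ %-congˡ (xy∙z≈xz∙y v k p) ⟩
  (v + p + k) % G  ∎)

-- k₀ solves the first congruence, and D ≡ q − (v + k₀) (mod N) is a multiple s G of G; by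
-- Bézout, adding x s M = D + s y N to k₀ keeps the first congruence and fixes the second.
crt-bézout : ∀ {M N G} .{{_ : NonZero M}} .{{_ : NonZero N}} .{{_ : NonZero G}} →
             G ∣ M → G ∣ N → ∀ x y → G + y * N ≡ x * M → ∀ u v p q → u + q ≡ v + p [mod G ] →
             ∃[ k ] u + k ≡ p [mod M ] × v + k ≡ q [mod N ]
crt-bézout {M} {N} {G} G∣M G∣N x y bézout u v p q u+q≡v+p = k₀ + x * s * M , u+k≡p , v+k≡q
  where
  k₀ = (M ∸ u % M) + p
  u+k₀≡p : u + k₀ ≡ p [mod M ]
  u+k₀≡p = trans (%-congˡ (sym (+-assoc u (M ∸ u % M) p))) (%-remove-+ˡ p (n∣m+[n∸m%n] M u))
  A = v + k₀
  D = (N ∸ A % N) + q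
  A+D≡q : A + D ≡ q [mod N ]
  A+D≡q = trans (%-congˡ (sym (+-assoc A (N ∸ A % N) q))) (%-remove-+ˡ q (n∣m+[n∸m%n] N A))
  q≡A : q ≡ A [mod G ]
  q≡A = +-cancelʳ-mod G u (begin
    (q + u) % G       ≡⟨ %-congˡ (+-comm q u) ⟩
    (u + q) % G       ≡⟨ u+q≡v+p ⟩
    (v + p) % G       ≡⟨ +-congˡ-mod G v (≡-mod-∣ G∣M u+k₀≡p) ⟨
    (v + (u + k₀)) % G ≡⟨ %-congˡ (trans (cong (v +_) (+-comm u k₀)) (sym (+-assoc v k₀ u))) ⟩
    (A + u) % G       ∎)
  G∣D : G ∣ D
  G∣D = m%n≡0⇒n∣m D G (trans (+-cancelʳ-mod G A (begin
    (D + A) % G  ≡⟨ %-congˡ (+-comm D A) ⟩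
    (A + D) % G  ≡⟨ ≡-mod-∣ G∣N A+D≡q ⟩
    q % G        ≡⟨ q≡A ⟩
    A % G        ∎)) (0%n≡0 G))
  s = _∣_.quotient G∣D
  xsM≡D+syN : x * s * M ≡ D + s * y * N
  xsM≡D+syN = begin
    x * s * M        ≡⟨ cong (_* M) (*-comm x s) ⟩
    s * x * M        ≡⟨ *-assoc s x M ⟩
    s * (x * M)      ≡⟨ cong (s *_) bézout ⟨
    s * (G + y * N)  ≡⟨ *-distribˡ-+ s G (y * N) ⟩
    s * G + s * (y * N) ≡⟨ cong₂ _+_ (sym (_∣_.equality G∣D)) (sym (*-assoc s y N)) ⟩
    D + s * y * N    ∎
  u+k≡p : u + (k₀ + x * s * M) ≡ p [mod M ]
  u+k≡p = trans (%-congˡ (sym (+-assoc u k₀ (x * s * M)))) (trans ([m+kn]%n≡m%n (u + k₀) (x * s) M) u+k₀≡p)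
  v+k≡q : v + (k₀ + x * s * M) ≡ q [mod N ]
  v+k≡q = begin
    (v + (k₀ + x * s * M)) % N  ≡⟨ %-congˡ (sym (+-assoc v k₀ (x * s * M))) ⟩
    (A + x * s * M) % N         ≡⟨ %-congˡ (cong (A +_) xsM≡D+syN) ⟩
    (A + (D + s * y * N)) % N   ≡⟨ %-congˡ (sym (+-assoc A D (s * y * N))) ⟩
    (A + D + s * y * N) % N     ≡⟨ [m+kn]%n≡m%n (A + D) (s * y) N ⟩
    (A + D) % N                 ≡⟨ A+D≡q ⟩
    q % N                       ∎

crt-unbounded : ∀ {M N G} .{{_ : NonZero M}} .{{_ : NonZero N}} .{{_ : NonZero G}} → GCD M N G →
                ∀ u v p q → u + q ≡ v + p [mod G ] →
                ∃[ k ] u + k ≡ p [mod M ] × v + k ≡ q [mod N ]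
crt-unbounded gcd u v p q u+q≡v+p with Bézout.identity gcd
... | Bézout.+- x y eq = crt-bézout (GCD.gcd∣m gcd) (GCD.gcd∣n gcd) x y eq u v p q u+q≡v+p
... | Bézout.-+ x y eq with k , v+k≡q , u+k≡p ← crt-bézout (GCD.gcd∣n gcd) (GCD.gcd∣m gcd) y x eq v u q p (sym u+q≡v+p)
  = k , u+k≡p , v+k≡q

crt : ∀ {M N G} .{{_ : NonZero M}} .{{_ : NonZero N}} .{{_ : NonZero G}} → GCD M N G →
      ∀ u v p q → u + q ≡ v + p [mod G ] →
      ∃[ k ] k < M * N × u + k ≡ p [mod M ] × v + k ≡ q [mod N ]
crt {M} {N} gcd u v p q u+q≡v+p with k , u+k≡p , v+k≡q ← crt-unbounded gcd u v p q u+q≡v+p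
  = k % (M * N) , m%n<n k (M * N)
  , trans (+-congˡ-mod M u (m∣n⇒o%n%m≡o%m M (M * N) k (m∣m*n N))) u+k≡p
  , trans (+-congˡ-mod N v (m∣n⇒o%n%m≡o%m N (M * N) k (n∣m*n M))) v+k≡q
  where instance _ = m*n≢0 M N

-- Arithmetic of ℤ/G on representatives below G: negate x = −x, a ⊖ b = a − b, abs x = min(x, −x).
module Negation (G : ℕ) .{{_ : NonZero G}} where

  negate : ℕ → ℕ
  negate x = (G ∸ x) % G

  abs : ℕ → ℕ
  abs x = x ⊓ negate x

  negate<G : ∀ x → negate x < G
  negate<G x = m%n<n (G ∸ x) G

  negate-inverseˡ : ∀ {x} → x < G → negate x + x ≡ 0 [mod G ]
  negate-inverseˡ {x} x<G = begin
    ((G ∸ x) % G + x) % G  ≡⟨ [m%n+k]%n≡[m+k]%n G (G ∸ x) x ⟩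
    (G ∸ x + x) % G        ≡⟨ %-congˡ (m∸n+n≡m (<⇒≤ x<G)) ⟩
    G % G                  ≡⟨ n%n≡0 G ⟩
    0                      ≡⟨ 0%n≡0 G ⟨
    0 % G                  ∎

  negate-unique : ∀ {x y} → x < G → y < G → y + x ≡ 0 [mod G ] → y ≡ negate x
  negate-unique {x} {y} x<G y<G y+x≡0 = begin
    y             ≡⟨ m<n⇒m%n≡m y<G ⟨
    y % G         ≡⟨ +-cancelʳ-mod G x (trans y+x≡0 (sym (negate-inverseˡ x<G))) ⟩
    negate x % G  ≡⟨ m%n%n≡m%n (G ∸ x) G ⟩
    negate x      ∎

  negate-involutive : ∀ {x} → x < G → negate (negate x) ≡ x
  negate-involutive {x} x<G = sym (negate-unique (negate<G x) x<G
    (trans (%-congˡ (+-comm x (negate x))) (negate-inverseˡ x<G)))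

  abs-injective : ∀ {x y} → x < G → y < G → abs x ≡ abs y → x ≡ y ⊎ x ≡ negate y
  abs-injective {x} {y} x<G y<G eq with ⊓-sel x (negate x) | ⊓-sel y (negate y)
  ... | inj₁ a | inj₁ b = inj₁ (trans (sym a) (trans eq b))
  ... | inj₁ a | inj₂ b = inj₂ (trans (sym a) (trans eq b))
  ... | inj₂ a | inj₁ b = inj₂ (trans (sym (negate-involutive x<G)) (cong negate (trans (sym a) (trans eq b))))
  ... | inj₂ a | inj₂ b = inj₁ (begin
    x                    ≡⟨ negate-involutive x<G ⟨
    negate (negate x)    ≡⟨ cong negate (trans (sym a) (trans eq b)) ⟩
    negate (negate y)    ≡⟨ negate-involutive y<G ⟩
    y                    ∎)

  abs-negate : ∀ {x} → x < G → abs (negate x) ≡ abs x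
  abs-negate {x} x<G = trans (⊓-comm (negate x) (negate (negate x))) (cong (_⊓ negate x) (negate-involutive x<G))

  abs-cong : ∀ {x y} → y < G → x ≡ y ⊎ x ≡ negate y → abs x ≡ abs y
  abs-cong y<G (inj₁ refl) = refl
  abs-cong y<G (inj₂ refl) = abs-negate y<G

  negate-divisible : ∀ {g x} .{{_ : NonZero g}} → g ∣ G → x < G → x % g ≡ 0 → negate x % g ≡ 0
  negate-divisible {g} {x} g∣G x<G x≡0 = begin
    negate x % g        ≡⟨ %-congˡ (+-identityʳ (negate x)) ⟨
    (negate x + 0) % g  ≡⟨ +-congˡ-mod g (negate x) (trans x≡0 (sym (0%n≡0 g))) ⟨
    (negate x + x) % g  ≡⟨ ≡-mod-∣ g∣G (negate-inverseˡ x<G) ⟩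
    0 % g               ≡⟨ 0%n≡0 g ⟩
    0                   ∎

  abs-divisible : ∀ {g x} .{{_ : NonZero g}} → g ∣ G → x < G → (abs x % g ≡ 0 ⇔ x % g ≡ 0)
  abs-divisible {g} {x} g∣G x<G with ⊓-sel x (negate x)
  ... | inj₁ abs≡x = mk⇔ (subst (λ a → a % g ≡ 0) abs≡x) (subst (λ a → a % g ≡ 0) (sym abs≡x))
  ... | inj₂ abs≡-x = mk⇔
    (λ a≡0 → subst (λ a → a % g ≡ 0) (negate-involutive x<G)
               (negate-divisible g∣G (negate<G x) (subst (λ a → a % g ≡ 0) abs≡-x a≡0)))
    (λ x≡0 → subst (λ a → a % g ≡ 0) (sym abs≡-x) (negate-divisible g∣G x<G x≡0))

  abs-half : ∀ {x} → x < G → abs x + abs x ≤ G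
  abs-half {zero} _ = z≤n
  abs-half {x@(suc _)} x<G =
    ≤-trans (+-mono-≤ (m⊓n≤m x (negate x)) (m⊓n≤n x (negate x))) (≤-reflexive (begin
      x + negate x  ≡⟨ cong (x +_) (m<n⇒m%n≡m (∸-monoʳ-< z<s (<⇒≤ x<G))) ⟩
      x + (G ∸ x)   ≡⟨ m+[n∸m]≡n (<⇒≤ x<G) ⟩
      G             ∎))

  abs-fixed : ∀ {x} → x + x ≤ G → abs x ≡ x
  abs-fixed {zero} _ = refl
  abs-fixed {x@(suc _)} x+x≤G = m≤n⇒m⊓n≡m (≤-trans (m+n≤o⇒m≤o∸n x x+x≤G)
    (≤-reflexive (sym (m<n⇒m%n≡m (∸-monoʳ-< z<s (m+n≤o⇒n≤o x x+x≤G))))))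

  infixl 7 _⊖_
  _⊖_ : ℕ → ℕ → ℕ
  a ⊖ b = (a + negate (b % G)) % G

  ⊖<G : ∀ a b → a ⊖ b < G
  ⊖<G a b = m%n<n _ G

  ⊖-+ : ∀ a b → a ⊖ b + b ≡ a [mod G ]
  ⊖-+ a b = begin
    ((a + negate (b % G)) % G + b) % G  ≡⟨ [m%n+k]%n≡[m+k]%n G (a + negate (b % G)) b ⟩
    (a + negate (b % G) + b) % G        ≡⟨ %-congˡ (+-assoc a (negate (b % G)) b) ⟩
    (a + (negate (b % G) + b)) % G      ≡⟨ +-congˡ-mod G a (begin
      (negate (b % G) + b) % G              ≡⟨ +-congˡ-mod G (negate (b % G)) (m%n%n≡m%n b G) ⟨
      (negate (b % G) + b % G) % G          ≡⟨ negate-inverseˡ (m%n<n b G) ⟩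
      0 % G                                 ∎) ⟩
    (a + 0) % G                         ≡⟨ %-congˡ (+-identityʳ a) ⟩
    a % G                               ∎

  ⊖-identityʳ : ∀ {a} → a < G → a ⊖ 0 ≡ a
  ⊖-identityʳ {a} a<G = begin
    a ⊖ 0            ≡⟨ m<n⇒m%n≡m (⊖<G a 0) ⟨
    (a ⊖ 0) % G      ≡⟨ %-congˡ (+-identityʳ (a ⊖ 0)) ⟨
    (a ⊖ 0 + 0) % G  ≡⟨ ⊖-+ a 0 ⟩
    a % G            ≡⟨ m<n⇒m%n≡m a<G ⟩
    a                ∎

  ⊖-≡⇔ : ∀ {a b a′ b′} → (a ⊖ b ≡ a′ ⊖ b′) ⇔ (a + b′ ≡ b + a′ [mod G ])
  ⊖-≡⇔ {a} {b} {a′} {b′} = mk⇔ to from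
    where
    to : a ⊖ b ≡ a′ ⊖ b′ → a + b′ ≡ b + a′ [mod G ]
    to eq = begin
      (a + b′) % G            ≡⟨ +-congʳ-mod G b′ (⊖-+ a b) ⟨
      (a ⊖ b + b + b′) % G    ≡⟨ %-congˡ (cong (λ x → x + b + b′) eq) ⟩
      (a′ ⊖ b′ + b + b′) % G  ≡⟨ %-congˡ (xy∙z≈xz∙y (a′ ⊖ b′) b b′) ⟩
      (a′ ⊖ b′ + b′ + b) % G  ≡⟨ +-congʳ-mod G b (⊖-+ a′ b′) ⟩
      (a′ + b) % G            ≡⟨ %-congˡ (+-comm a′ b) ⟩
      (b + a′) % G            ∎
    from : a + b′ ≡ b + a′ [mod G ] → a ⊖ b ≡ a′ ⊖ b′
    from eq = begin
      a ⊖ b             ≡⟨ m%n%n≡m%n _ G ⟨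
      (a ⊖ b) % G       ≡⟨ +-cancelʳ-mod G (b + b′) (begin
        (a ⊖ b + (b + b′)) % G    ≡⟨ %-congˡ (+-assoc (a ⊖ b) b b′) ⟨
        (a ⊖ b + b + b′) % G      ≡⟨ +-congʳ-mod G b′ (⊖-+ a b) ⟩
        (a + b′) % G              ≡⟨ eq ⟩
        (b + a′) % G              ≡⟨ %-congˡ (+-comm b a′) ⟩
        (a′ + b) % G              ≡⟨ +-congʳ-mod G b (⊖-+ a′ b′) ⟨
        (a′ ⊖ b′ + b′ + b) % G    ≡⟨ %-congˡ (trans (+-assoc (a′ ⊖ b′) b′ b) (cong (a′ ⊖ b′ +_) (+-comm b′ b))) ⟩
        (a′ ⊖ b′ + (b + b′)) % G  ∎) ⟩
      (a′ ⊖ b′) % G     ≡⟨ m%n%n≡m%n _ G ⟩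
      a′ ⊖ b′           ∎

  ⊖-negate : ∀ {a b a′ b′} → a + a′ ≡ b + b′ [mod G ] → a′ ⊖ b′ ≡ negate (a ⊖ b)
  ⊖-negate {a} {b} {a′} {b′} eq = negate-unique (⊖<G a b) (⊖<G a′ b′) (+-cancelʳ-mod G (b + b′) (begin
    (a′ ⊖ b′ + a ⊖ b + (b + b′)) % G    ≡⟨ %-congˡ (shuffle (a′ ⊖ b′) (a ⊖ b) b b′) ⟩
    (a ⊖ b + b + (a′ ⊖ b′ + b′)) % G    ≡⟨ +-congʳ-mod G (a′ ⊖ b′ + b′) (⊖-+ a b) ⟩
    (a + (a′ ⊖ b′ + b′)) % G            ≡⟨ +-congˡ-mod G a (⊖-+ a′ b′) ⟩
    (a + a′) % G                        ≡⟨ eq ⟩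
    (b + b′) % G                        ≡⟨ %-congˡ (+-identityˡ (b + b′)) ⟨
    (0 + (b + b′)) % G                  ∎))
    where
    shuffle : ∀ w x y z → w + x + (y + z) ≡ x + y + (w + z)
    shuffle = solve-∀

  ⊖-divisible : ∀ {g} .{{_ : NonZero g}} → g ∣ G → ∀ a b → ((a ⊖ b) % g ≡ 0) ⇔ (a ≡ b [mod g ])
  ⊖-divisible {g} g∣G a b = mk⇔
    (λ d≡0 → begin
      a % g                ≡⟨ ≡-mod-∣ g∣G (⊖-+ a b) ⟨
      (a ⊖ b + b) % g      ≡⟨ +-congʳ-mod g b (trans d≡0 (sym (0%n≡0 g))) ⟩
      (0 + b) % g          ∎)
    (λ a≡b → trans (+-cancelʳ-mod g b (begin
      (a ⊖ b + b) % g      ≡⟨ ≡-mod-∣ g∣G (⊖-+ a b) ⟩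
      a % g                ≡⟨ a≡b ⟩
      (0 + b) % g          ∎)) (0%n≡0 g))

newDir-interior : ∀ {M a} d → a ≢ 0 → a ≢ M → newDir M a d ≡ d
newDir-interior {M} {a} d a≢0 a≢M
  rewrite dec-false (a ≟ 0) a≢0 | dec-false (a ≟ M) a≢M = refl

newDir-max : ∀ M .{{_ : NonZero M}} d → newDir M M d ≡ false
newDir-max M d rewrite dec-false (M ≟ 0) (≢-nonZero⁻¹ M) | dec-true (M ≟ M) refl = refl

m∸n∸1≡m∸[1+n] : ∀ m n → m ∸ n ∸ 1 ≡ m ∸ suc n
m∸n∸1≡m∸[1+n] m n = trans (∸-+-assoc m n 1) (cong (m ∸_) (+-comm n 1))

bounce : ℕ → ℕ × Bool → ℕ × Bool
bounce M (x , d) = mv d x , newDir M (mv d x) d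

state : ℕ × Bool → ℕ × Bool → State
state (x , dx) (y , dy) = st x y dx dy

cell : ℕ × Bool → ℕ
cell (x , d) = x ⊓ mv d x

start : ℕ → Bool → ℕ × Bool
start i true  = i , true
start i false = suc i , false

cell-start : ∀ i d → cell (start i d) ≡ i
cell-start i true  = m≤n⇒m⊓n≡m (n≤1+n i)
cell-start i false = m≥n⇒m⊓n≡n (n≤1+n i)

atWall : ℕ → ℕ → Bool
atWall M x = (x ≡ᵇ 0) ∨ (x ≡ᵇ M)

atWall-low : ∀ {M a} → a < M → T (atWall M a) ⇔ a ≡ 0
atWall-low {M} {a} a<M rewrite dec-false (a ≟ M) (<⇒≢ a<M) | ∨-identityʳ (a ≡ᵇ 0) =
  mk⇔ (≡ᵇ⇒≡ a 0) (≡⇒≡ᵇ a 0)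

atWall-high : ∀ {M r} → r < M → T (atWall M (M ∸ r)) ⇔ r ≡ 0
atWall-high {M} {zero} _ = mk⇔ (λ _ → refl) (λ _ → Equivalence.from T-∨ (inj₂ (≡⇒≡ᵇ M M refl)))
atWall-high {M} {r@(suc _)} r<M rewrite dec-false (M ∸ r ≟ 0) (m>n⇒m∸n≢0 r<M) =
  mk⇔ (λ t → contradiction (≡ᵇ⇒≡ (M ∸ r) M t) (<⇒≢ (∸-monoʳ-< z<s (<⇒≤ r<M)))) (λ ())

module Unfolding (M : ℕ) .{{_ : NonZero M}} where

  instance
    2M-nonZero : NonZero (2 * M)
    2M-nonZero = m*n≢0 2 M

  2M≡M+M : 2 * M ≡ M + M
  2M≡M+M = cong (M +_) (+-identityʳ M)

  M<2M : M < 2 * M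
  M<2M = subst (M <_) (sym 2M≡M+M) (m<m+n M (>-nonZero⁻¹ M))

  2M∸a<M : ∀ {a} → M ≤ a → 2 * M ∸ suc a < M
  2M∸a<M {a} M≤a = m<n+o⇒m∸n<o (2 * M) (suc a) (subst (_< suc a + M) (sym 2M≡M+M) (+-monoˡ-< M (s≤s M≤a)))

  -- Position and heading (true = increasing) of a coordinate bouncing in [0, M] after a steps from 0.
  unfold : ℕ → ℕ × Bool
  unfold a = if a <ᵇ M then (a , true) else (2 * M ∸ a , false)

  unfold-low : ∀ {a} → a < M → unfold a ≡ (a , true)
  unfold-low {a} a<M rewrite dec-true (a <? M) a<M = refl

  unfold-high : ∀ {a} → M ≤ a → unfold a ≡ (2 * M ∸ a , false)
  unfold-high {a} M≤a rewrite dec-false (a <? M) (≤⇒≯ M≤a) = refl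

  bounce-unfold : ∀ {a} → a < 2 * M → bounce M (unfold a) ≡ unfold (suc a % (2 * M))
  bounce-unfold {a} a<2M with <-cmp (suc a) M
  ... | tri< 1+a<M _ _ = begin
    bounce M (unfold a)                 ≡⟨ cong (bounce M) (unfold-low (<-trans (n<1+n a) 1+a<M)) ⟩
    (suc a , newDir M (suc a) true)     ≡⟨ cong (suc a ,_) (newDir-interior true (λ ()) (<⇒≢ 1+a<M)) ⟩
    (suc a , true)                      ≡⟨ unfold-low 1+a<M ⟨
    unfold (suc a)                      ≡⟨ cong unfold (m<n⇒m%n≡m (<-trans 1+a<M M<2M)) ⟨
    unfold (suc a % (2 * M))            ∎
  ... | tri≈ _ 1+a≡M _ = begin
    bounce M (unfold a)                 ≡⟨ cong (bounce M) (unfold-low (subst (a <_) 1+a≡M (n<1+n a))) ⟩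
    (suc a , newDir M (suc a) true)     ≡⟨ cong (λ x → x , newDir M x true) 1+a≡M ⟩
    (M , newDir M M true)               ≡⟨ cong (M ,_) (newDir-max M true) ⟩
    (M , false)                         ≡⟨ cong (_, false) (trans (cong (_∸ M) 2M≡M+M) (m+n∸m≡n M M)) ⟨
    (2 * M ∸ M , false)                 ≡⟨ unfold-high ≤-refl ⟨
    unfold M                            ≡⟨ cong unfold (m<n⇒m%n≡m M<2M) ⟨
    unfold (M % (2 * M))                ≡⟨ cong (λ x → unfold (x % (2 * M))) 1+a≡M ⟨
    unfold (suc a % (2 * M))            ∎
  ... | tri> _ _ M<1+a with m≤n⇒m<n∨m≡n a<2M
  ...   | inj₁ 1+a<2M = begin
    bounce M (unfold a)                 ≡⟨ cong (bounce M) (unfold-high (s≤s⁻¹ M<1+a)) ⟩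
    (2 * M ∸ a ∸ 1 , newDir M (2 * M ∸ a ∸ 1) false)
                                        ≡⟨ cong (λ x → x , newDir M x false) (m∸n∸1≡m∸[1+n] (2 * M) a) ⟩
    (2 * M ∸ suc a , newDir M (2 * M ∸ suc a) false)
                                        ≡⟨ cong (2 * M ∸ suc a ,_) (newDir-interior false
                                             (m>n⇒m∸n≢0 1+a<2M) (<⇒≢ (2M∸a<M (s≤s⁻¹ M<1+a)))) ⟩
    (2 * M ∸ suc a , false)             ≡⟨ unfold-high (<⇒≤ M<1+a) ⟨
    unfold (suc a)                      ≡⟨ cong unfold (m<n⇒m%n≡m 1+a<2M) ⟨
    unfold (suc a % (2 * M))            ∎
  ...   | inj₂ 1+a≡2M = begin
    bounce M (unfold a)                 ≡⟨ cong (bounce M) (unfold-high (s≤s⁻¹ M<1+a)) ⟩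
    (2 * M ∸ a ∸ 1 , newDir M (2 * M ∸ a ∸ 1) false)
                                        ≡⟨ cong (λ x → x , newDir M x false)
                                             (trans (m∸n∸1≡m∸[1+n] (2 * M) a)
                                               (trans (cong (2 * M ∸_) 1+a≡2M) (n∸n≡0 (2 * M)))) ⟩
    (0 , true)                          ≡⟨ unfold-low (>-nonZero⁻¹ M) ⟨
    unfold 0                            ≡⟨ cong unfold (n%n≡0 (2 * M)) ⟨
    unfold (2 * M % (2 * M))            ≡⟨ cong (λ x → unfold (x % (2 * M))) 1+a≡2M ⟨
    unfold (suc a % (2 * M))            ∎

  -- The unfolded coordinate whose next move crosses [i, i + 1] with heading d.
  uncell : ℕ → Bool → ℕ
  uncell i true  = i
  uncell i false = 2 * M ∸ suc i

  M≤2M∸[1+i] : ∀ {i} → i < M → M ≤ 2 * M ∸ suc i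
  M≤2M∸[1+i] {i} i<M = m+n≤o⇒m≤o∸n M (subst (M + suc i ≤_) (sym 2M≡M+M) (+-monoʳ-≤ M i<M))

  uncell<2M : ∀ {i} d → i < M → uncell i d < 2 * M
  uncell<2M true  i<M = <-trans i<M M<2M
  uncell<2M false i<M = ∸-monoʳ-< z<s (<-trans i<M M<2M)

  unfold-uncell : ∀ {i} d → i < M → unfold (uncell i d) ≡ start i d
  unfold-uncell true  i<M = unfold-low i<M
  unfold-uncell {i} false i<M = begin
    unfold (2 * M ∸ suc i)                 ≡⟨ unfold-high (M≤2M∸[1+i] i<M) ⟩
    (2 * M ∸ (2 * M ∸ suc i) , false)      ≡⟨ cong (_, false) (m∸[m∸n]≡n (<-trans i<M M<2M)) ⟩
    (suc i , false)                        ∎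

  uncell-unfold : ∀ {a} → a < 2 * M → uncell (cell (unfold a)) (proj₂ (unfold a)) ≡ a
  uncell-unfold {a} a<2M with a <? M
  ... | yes a<M rewrite unfold-low a<M = m≤n⇒m⊓n≡m (n≤1+n a)
  ... | no a≮M rewrite unfold-high (≮⇒≥ a≮M) = begin
    2 * M ∸ suc ((2 * M ∸ a) ⊓ (2 * M ∸ a ∸ 1))  ≡⟨ cong (λ x → 2 * M ∸ suc x) (m≥n⇒m⊓n≡n (m∸n≤m (2 * M ∸ a) 1)) ⟩
    2 * M ∸ suc (2 * M ∸ a ∸ 1)                  ≡⟨ cong (λ x → 2 * M ∸ suc x) (m∸n∸1≡m∸[1+n] (2 * M) a) ⟩
    2 * M ∸ suc (2 * M ∸ suc a)                  ≡⟨ cong (2 * M ∸_) (+-∸-assoc 1 a<2M) ⟨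
    2 * M ∸ (2 * M ∸ a)                          ≡⟨ m∸[m∸n]≡n (<⇒≤ a<2M) ⟩
    a                                            ∎

  atWall-unfold< : ∀ {a} → a < 2 * M → T (atWall M (proj₁ (unfold a))) ⇔ a % M ≡ 0
  atWall-unfold< {a} a<2M with a <? M
  ... | yes a<M rewrite unfold-low a<M | m<n⇒m%n≡m a<M = atWall-low a<M
  ... | no a≮M with r , refl ← m≤n⇒∃[o]m+o≡n (≮⇒≥ a≮M) = atWall-reflected
    where
    r<M : r < M
    r<M = +-cancelˡ-< M r M (subst (M + r <_) 2M≡M+M a<2M)
    [M+r]%M≡r : (M + r) % M ≡ r
    [M+r]%M≡r = trans (%-remove-+ˡ r ∣-refl) (m<n⇒m%n≡m r<M)
    atWall-reflected : T (atWall M (proj₁ (unfold (M + r)))) ⇔ (M + r) % M ≡ 0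
    atWall-reflected rewrite unfold-high (m≤m+n M r) | cong (_∸ (M + r)) 2M≡M+M | [m+n]∸[m+o]≡n∸o M M r =
      subst (λ x → T (atWall M (M ∸ r)) ⇔ x ≡ 0) (sym [M+r]%M≡r) (atWall-high r<M)

  atWall-unfold : ∀ a → T (atWall M (proj₁ (unfold (a % (2 * M))))) ⇔ a % M ≡ 0
  atWall-unfold a = subst (λ x → T (atWall M (proj₁ (unfold (a % (2 * M))))) ⇔ x ≡ 0)
    (m∣n⇒o%n%m≡o%m M (2 * M) a (n∣m*n 2)) (atWall-unfold< (m%n<n a (2 * M)))

  bounce-unfold-% : ∀ a → bounce M (unfold (a % (2 * M))) ≡ unfold (suc a % (2 * M))
  bounce-unfold-% a = trans (bounce-unfold (m%n<n a (2 * M))) (cong unfold (begin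
    suc (a % (2 * M)) % (2 * M)    ≡⟨ %-congˡ {o = 2 * M} (+-comm 1 (a % (2 * M))) ⟩
    (a % (2 * M) + 1) % (2 * M)    ≡⟨ [m%n+k]%n≡[m+k]%n (2 * M) a 1 ⟩
    (a + 1) % (2 * M)              ≡⟨ %-congˡ {o = 2 * M} (+-comm a 1) ⟩
    suc a % (2 * M)                ∎))

  unfold-uncell-% : ∀ {i} d → i < M → unfold (uncell i d % (2 * M)) ≡ start i d
  unfold-uncell-% d i<M = trans (cong unfold (m<n⇒m%n≡m (uncell<2M d i<M))) (unfold-uncell d i<M)

  ≡-uncell : ∀ a {i d} → i < M → cell (unfold (a % (2 * M))) ≡ i → proj₂ (unfold (a % (2 * M))) ≡ d →
             a ≡ uncell i d [mod 2 * M ]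
  ≡-uncell a {d = d} i<M refl refl =
    trans (sym (uncell-unfold (m%n<n a (2 * M)))) (sym (m<n⇒m%n≡m (uncell<2M d i<M)))

  uncell-sum : ∀ {i} d → i < M → suc (uncell i d + uncell i (not d)) ≡ 2 * M
  uncell-sum {i} true  i<M = m+[n∸m]≡n (<-trans i<M M<2M)
  uncell-sum {i} false i<M = trans (cong suc (+-comm (2 * M ∸ suc i) i)) (m+[n∸m]≡n (<-trans i<M M<2M))

T-injective : ∀ {b c} → (T b ⇔ T c) → b ≡ c
T-injective {true}  {true}  _   = refl
T-injective {true}  {false} b⇔c = ⊥-elim (Equivalence.to b⇔c _)
T-injective {false} {true}  b⇔c = ⊥-elim (Equivalence.from b⇔c _)
T-injective {false} {false} _   = refl

==ᵇ⇒≡ : ∀ b c → T (b ==ᵇ c) → b ≡ c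
==ᵇ⇒≡ true  true  _ = refl
==ᵇ⇒≡ false false _ = refl

==ᵇ-refl : ∀ b → T (b ==ᵇ b)
==ᵇ-refl true  = _
==ᵇ-refl false = _

=ᴰ⇔≡ : ∀ {d e} → T (d =ᴰ e) ⇔ d ≡ e
=ᴰ⇔≡ {dg i j b} {dg i′ j′ b′} = mk⇔ to from
  where
  to : T (dg i j b =ᴰ dg i′ j′ b′) → dg i j b ≡ dg i′ j′ b′
  to t with ti , t′ ← Equivalence.to T-∧ t with tj , tb ← Equivalence.to T-∧ t′
    with refl ← ≡ᵇ⇒≡ i i′ ti | refl ← ≡ᵇ⇒≡ j j′ tj | refl ← ==ᵇ⇒≡ b b′ tb = refl
  from : dg i j b ≡ dg i′ j′ b′ → T (dg i j b =ᴰ dg i′ j′ b′)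
  from refl = Equivalence.from T-∧ (≡⇒≡ᵇ i i refl , Equivalence.from T-∧ (≡⇒≡ᵇ j j refl , ==ᵇ-refl b))

orientation : ∀ {β} hx hy → (hx ==ᵇ hy) ≡ β → (hx ≡ β × hy ≡ true) ⊎ (hx ≡ not β × hy ≡ false)
orientation true  true  refl = inj₁ (refl , refl)
orientation false true  refl = inj₁ (refl , refl)
orientation true  false refl = inj₂ (refl , refl)
orientation false false refl = inj₂ (refl , refl)

diagOf-startFwd : ∀ e → diagOf (startFwd e) ≡ e
diagOf-startFwd (dg i j true)  = cong₂ (λ x y → dg x y true)  (cell-start i true)  (cell-start j true)
diagOf-startFwd (dg i j false) = cong₂ (λ x y → dg x y false) (cell-start i false) (cell-start j true)

diagOf-startBwd : ∀ e → diagOf (startBwd e) ≡ e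
diagOf-startBwd (dg i j true)  = cong₂ (λ x y → dg x y true)  (cell-start i false) (cell-start j false)
diagOf-startBwd (dg i j false) = cong₂ (λ x y → dg x y false) (cell-start i true)  (cell-start j false)

any-++ : ∀ {A : Set} (P : A → Bool) xs ys → T (any P (xs ++ ys)) ⇔ (T (any P xs) ⊎ T (any P ys))
any-++ P xs ys = mk⇔
  (λ t → Data.Sum.map (any⁺ P) (any⁺ P) (++⁻ xs (any⁻ P (xs ++ ys) t)))
  [ (λ t → any⁺ P (++⁺ˡ (any⁻ P xs t))) , (λ t → any⁺ P (++⁺ʳ xs (any⁻ P ys t))) ]

any-orbit : ∀ m n s (P : State → Bool) →
            T (any P (orbit m n s)) ⇔ (∃[ k ] k < bound m n × T (P (iter k (step m n) s)))
any-orbit m n s P = mk⇔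
  (λ t → let k , k∈ , Pk = find (map⁻ (any⁻ P _ t)) in k , ∈-upTo⁻ k∈ , Pk)
  (λ (k , k<bound , Pk) → any⁺ P (map⁺ (lose (∈-upTo⁺ k<bound) Pk)))

sumBelow : ℕ → (ℕ → ℕ) → ℕ
sumBelow zero    f = 0
sumBelow (suc K) f = sumBelow K f + f K

sumBelow-cong : ∀ K {f h} → (∀ k → k < K → f k ≡ h k) → sumBelow K f ≡ sumBelow K h
sumBelow-cong zero    eq = refl
sumBelow-cong (suc K) eq = cong₂ _+_ (sumBelow-cong K (λ k k<K → eq k (m<n⇒m<1+n k<K))) (eq K (n<1+n K))

sumBelow-zero : ∀ K {f} → (∀ k → k < K → f k ≡ 0) → sumBelow K f ≡ 0
sumBelow-zero zero    _     = refl
sumBelow-zero (suc K) zeros = cong₂ _+_ (sumBelow-zero K (λ k k<K → zeros k (m<n⇒m<1+n k<K))) (zeros K (n<1+n K))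

sumBelow-update : ∀ K {f h k₀} c → k₀ < K → (∀ k → k ≢ k₀ → f k ≡ h k) → f k₀ ≡ c + h k₀ →
                  sumBelow K f ≡ c + sumBelow K h
sumBelow-update (suc K) {f} {h} {k₀} c k₀<1+K elsewhere at-k₀ with K ≟ k₀
... | yes refl = begin
  sumBelow K f + f K        ≡⟨ cong₂ _+_ (sumBelow-cong K (λ k k<K → elsewhere k (<⇒≢ k<K))) at-k₀ ⟩
  sumBelow K h + (c + h K)  ≡⟨ x∙yz≈y∙xz (sumBelow K h) c (h K) ⟩
  c + (sumBelow K h + h K)  ∎
... | no K≢k₀ = begin
  sumBelow K f + f K        ≡⟨ cong₂ _+_ (sumBelow-update K c (≤∧≢⇒< (s≤s⁻¹ k₀<1+K) (K≢k₀ ∘ sym)) elsewhere at-k₀)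
                                         (elsewhere K K≢k₀) ⟩
  c + sumBelow K h + h K    ≡⟨ +-assoc c (sumBelow K h) (h K) ⟩
  c + (sumBelow K h + h K)  ∎

sumBelow-interval : ∀ K {f} → f 0 ≡ 0 → (∀ k → 0 < k → k < K → f k ≡ 1) → sumBelow K f ≡ K ∸ 1
sumBelow-interval zero          f0≡0 _    = refl
sumBelow-interval (suc zero)    f0≡0 _    = f0≡0
sumBelow-interval (suc (suc K)) f0≡0 ones = trans
  (cong₂ _+_ (sumBelow-interval (suc K) f0≡0 (λ k 0<k k<1+K → ones k 0<k (m<n⇒m<1+n k<1+K))) (ones (suc K) z<s ≤-refl))
  (+-comm K 1)

module Counting {m n : ℕ} (InRange : Diag → Set) (key : Diag → ℕ) (openKey : ℕ → Bool) (K : ℕ)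
  (same-trajectory : ∀ {d e} → InRange d → InRange e → T (sameTraj m n d e) ⇔ (key d ≡ key e))
  (open-trajectory : ∀ {d} → InRange d → isOpen m n d ≡ openKey (key d))
  (key<K : ∀ d → key d < K) where

  hits : List Diag → ℕ → Bool
  hits L k = any (λ e → key e ≡ᵇ k) L

  newClosed : List Diag → List Diag → ℕ → ℕ
  newClosed seen L k = if not (openKey k) ∧ hits L k ∧ not (hits seen k) then 1 else 0

  sameTraj-hits : ∀ {d} seen → InRange d → All InRange seen → any (sameTraj m n d) seen ≡ hits seen (key d)
  sameTraj-hits []         d∈ []          = refl
  sameTraj-hits (e ∷ seen) d∈ (e∈ ∷ seen∈) = cong₂ _∨_
    (T-injective (⇔-trans (same-trajectory d∈ e∈) (mk⇔ (λ eq → ≡⇒≡ᵇ _ _ (sym eq)) (λ t → sym (≡ᵇ⇒≡ _ _ t)))))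
    (sameTraj-hits seen d∈ seen∈)

  newClosed-step : ∀ d seen L k → k ≢ key d → newClosed seen (d ∷ L) k ≡ newClosed (d ∷ seen) L k
  newClosed-step d seen L k k≢key rewrite dec-false (key d ≟ k) (k≢key ∘ sym) = refl

  newClosed-key : ∀ a b c → (if a ∧ (true ∨ b) ∧ not c then 1 else 0)
                           ≡ (if a ∧ not c then 1 else 0) + (if a ∧ b ∧ not (true ∨ c) then 1 else 0)
  newClosed-key true  true  true  = refl
  newClosed-key true  true  false = refl
  newClosed-key true  false true  = refl
  newClosed-key true  false false = refl
  newClosed-key false b     c     = refl

  countClasses-keys : ∀ seen L → All InRange seen → All InRange L →
                      countClasses m n seen L ≡ sumBelow K (newClosed seen L)
  countClasses-keys seen [] seen∈ [] = sym (sumBelow-zero K λ k _ → nothing-new (not (openKey k)) (hits seen k))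
    where
    nothing-new : ∀ a c → (if a ∧ false ∧ not c then 1 else 0) ≡ 0
    nothing-new true  c = refl
    nothing-new false c = refl
  countClasses-keys seen (d ∷ L) seen∈ (d∈ ∷ L∈)
    rewrite open-trajectory d∈ | sameTraj-hits seen d∈ seen∈ | countClasses-keys (d ∷ seen) L (d∈ ∷ seen∈) L∈
    = sym (sumBelow-update K new (key<K d) (newClosed-step d seen L) at-key)
    where
    new : ℕ
    new = if not (openKey (key d)) ∧ not (hits seen (key d)) then 1 else 0
    at-key : newClosed seen (d ∷ L) (key d) ≡ new + newClosed (d ∷ seen) L (key d)
    at-key rewrite dec-true (key d ≟ key d) refl = newClosed-key (not (openKey (key d))) (hits L (key d)) (hits seen (key d))

module Billiard (m n : ℕ) .{{_ : NonZero m}} .{{_ : NonZero n}} where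

  module X = Unfolding m
  module Y = Unfolding n
  open X using (2M-nonZero)
  open Y using () renaming (2M-nonZero to 2N-nonZero)

  beam : ℕ × ℕ → State
  beam (a , b) = state (X.unfold (a % (2 * m))) (Y.unfold (b % (2 * n)))

  shift : ℕ → ℕ × ℕ → ℕ × ℕ
  shift k (a , b) = a + k , b + k

  iterate-beam : ∀ k p → iter k (step m n) (beam p) ≡ beam (shift k p)
  iterate-beam zero    (a , b) = cong beam (sym (cong₂ _,_ (+-identityʳ a) (+-identityʳ b)))
  iterate-beam (suc k) (a , b) = begin
    iter k (step m n) (step m n (beam (a , b)))  ≡⟨ cong (iter k (step m n))
                                                      (cong₂ state (X.bounce-unfold-% a) (Y.bounce-unfold-% b)) ⟩
    iter k (step m n) (beam (suc a , suc b))     ≡⟨ iterate-beam k (suc a , suc b) ⟩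
    beam (suc a + k , suc b + k)                 ≡⟨ cong beam (cong₂ _,_ (+-suc a k) (+-suc b k)) ⟨
    beam (a + suc k , b + suc k)                 ∎

  infix 4 _≈_
  _≈_ : ℕ × ℕ → ℕ × ℕ → Set
  (a , b) ≈ (a′ , b′) = a ≡ a′ [mod 2 * m ] × b ≡ b′ [mod 2 * n ]

  beam-cong : ∀ {p q} → p ≈ q → beam p ≡ beam q
  beam-cong (a≡a′ , b≡b′) = cong₂ state (cong X.unfold a≡a′) (cong Y.unfold b≡b′)

  InRange : Diag → Set
  InRange (dg i j _) = i < m × j < n

  fwd bwd : Diag → ℕ × ℕ
  fwd (dg i j β) = X.uncell i β , Y.uncell j true
  bwd (dg i j β) = X.uncell i (not β) , Y.uncell j false

  beam-fwd : ∀ e → InRange e → beam (fwd e) ≡ startFwd e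
  beam-fwd (dg i j true)  (i<m , j<n) = cong₂ state (X.unfold-uncell-% true i<m)  (Y.unfold-uncell-% true j<n)
  beam-fwd (dg i j false) (i<m , j<n) = cong₂ state (X.unfold-uncell-% false i<m) (Y.unfold-uncell-% true j<n)

  beam-bwd : ∀ e → InRange e → beam (bwd e) ≡ startBwd e
  beam-bwd (dg i j true)  (i<m , j<n) = cong₂ state (X.unfold-uncell-% false i<m) (Y.unfold-uncell-% false j<n)
  beam-bwd (dg i j false) (i<m , j<n) = cong₂ state (X.unfold-uncell-% true i<m)  (Y.unfold-uncell-% false j<n)

  diagOf-beam : ∀ p e → InRange e → diagOf (beam p) ≡ e → p ≈ fwd e ⊎ p ≈ bwd e
  diagOf-beam (a , b) (dg i j β) (i<m , j<n) eq
    with orientation (proj₂ (X.unfold (a % (2 * m)))) (proj₂ (Y.unfold (b % (2 * n)))) (cong Diag.main eq)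
  ... | inj₁ (hx≡β , hy≡true)   =
    inj₁ (X.≡-uncell a i<m (cong Diag.i eq) hx≡β , Y.≡-uncell b j<n (cong Diag.j eq) hy≡true)
  ... | inj₂ (hx≡¬β , hy≡false) =
    inj₂ (X.≡-uncell a i<m (cong Diag.i eq) hx≡¬β , Y.≡-uncell b j<n (cong Diag.j eq) hy≡false)

  g : ℕ
  g = gcd m n

  instance
    g-nonZero : NonZero g
    g-nonZero = ≢-nonZero (gcd[m,n]≢0 m n (inj₁ (≢-nonZero⁻¹ m)))

  G : ℕ
  G = 2 * g

  instance
    G-nonZero : NonZero G
    G-nonZero = m*n≢0 2 g

  GCD[2m,2n,G] : GCD (2 * m) (2 * n) G
  GCD[2m,2n,G] = subst (GCD (2 * m) (2 * n)) (sym (c*gcd[m,n]≡gcd[cm,cn] 2 m n)) (gcd-GCD (2 * m) (2 * n))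

  open Negation G

  diff : ℕ × ℕ → ℕ
  diff (a , b) = a ⊖ b

  shift-diff : ∀ {p q} k → shift k p ≈ q → diff p ≡ diff q
  shift-diff k (a+k≡a′ , b+k≡b′) = Equivalence.from ⊖-≡⇔
    (crt-necessary k (GCD.gcd∣m GCD[2m,2n,G]) (GCD.gcd∣n GCD[2m,2n,G]) a+k≡a′ b+k≡b′)

  2m*2n≤bound : 2 * m * (2 * n) ≤ bound m n
  2m*2n≤bound = ≤-trans (≤-reflexive (2x*2y≡4*[x*y] m n)) (*-monoʳ-≤ 4 (*-mono-≤ (n≤1+n m) (n≤1+n n)))
    where
    2x*2y≡4*[x*y] : ∀ x y → 2 * x * (2 * y) ≡ 4 * (x * y)
    2x*2y≡4*[x*y] = solve-∀

  diff-shift : ∀ {p q} → diff p ≡ diff q → ∃[ k ] k < bound m n × shift k p ≈ q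
  diff-shift {a , b} {a′ , b′} eq =
    let k , k<4mn , p+k≈q = crt GCD[2m,2n,G] a b a′ b′ (Equivalence.to ⊖-≡⇔ eq)
    in k , <-≤-trans k<4mn 2m*2n≤bound , p+k≈q

  Visits : Diag → State → Bool
  Visits e s = diagOf s =ᴰ e

  meets : ∀ p e → InRange e →
          T (any (Visits e) (orbit m n (beam p))) ⇔ (diff p ≡ diff (fwd e) ⊎ diff p ≡ diff (bwd e))
  meets p e e∈ = mk⇔ to [ reach (fwd e) (beam-fwd e e∈) (diagOf-startFwd e) , reach (bwd e) (beam-bwd e e∈) (diagOf-startBwd e) ]
    where
    to : T (any (Visits e) (orbit m n (beam p))) → diff p ≡ diff (fwd e) ⊎ diff p ≡ diff (bwd e)
    to t =
      let k , _ , visit = Equivalence.to (any-orbit m n (beam p) (Visits e)) t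
      in Data.Sum.map (shift-diff k) (shift-diff k) (diagOf-beam (shift k p) e e∈
           (Equivalence.to =ᴰ⇔≡ (subst (λ s → T (Visits e s)) (iterate-beam k p) visit)))
    reach : ∀ q {s} → beam q ≡ s → diagOf s ≡ e → diff p ≡ diff q → T (any (Visits e) (orbit m n (beam p)))
    reach q refl visit eq =
      let k , k<bound , p+k≈q = diff-shift eq
      in Equivalence.from (any-orbit m n (beam p) (Visits e)) (k , k<bound ,
           Equivalence.from =ᴰ⇔≡ (trans (cong diagOf (trans (iterate-beam k p) (beam-cong p+k≈q))) visit))

  corner-beam : ∀ a b → T (isCorner m n (beam (a , b))) ⇔ (a % m ≡ 0 × b % n ≡ 0)
  corner-beam a b = mk⇔
    (λ t → let tx , ty = Equivalence.to T-∧ t in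
           Equivalence.to (X.atWall-unfold a) tx , Equivalence.to (Y.atWall-unfold b) ty)
    (λ (a≡0 , b≡0) → Equivalence.from T-∧
           (Equivalence.from (X.atWall-unfold a) a≡0 , Equivalence.from (Y.atWall-unfold b) b≡0))

  m*n≤bound : m * n ≤ bound m n
  m*n≤bound = ≤-trans (*-mono-≤ (n≤1+n m) (n≤1+n n)) (m≤n*m (suc m * suc n) 4)

  corners : ∀ a b → T (any (isCorner m n) (orbit m n (beam (a , b)))) ⇔ a ≡ b [mod g ]
  corners a b = mk⇔ to from
    where
    strip : ∀ {x y} → x + 0 ≡ y + 0 [mod g ] → x ≡ y [mod g ]
    strip = subst₂ (λ x y → x ≡ y [mod g ]) (+-identityʳ _) (+-identityʳ _)
    strip⁻¹ : ∀ {x y} → x ≡ y [mod g ] → x + 0 ≡ y + 0 [mod g ]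
    strip⁻¹ = subst₂ (λ x y → x ≡ y [mod g ]) (sym (+-identityʳ _)) (sym (+-identityʳ _))
    to : T (any (isCorner m n) (orbit m n (beam (a , b)))) → a ≡ b [mod g ]
    to t =
      let k , _ , corner = Equivalence.to (any-orbit m n (beam (a , b)) (isCorner m n)) t
          a+k≡0 , b+k≡0 = Equivalence.to (corner-beam (a + k) (b + k))
                            (subst (λ s → T (isCorner m n s)) (iterate-beam k (a , b)) corner)
      in strip (crt-necessary k (GCD.gcd∣m (gcd-GCD m n)) (GCD.gcd∣n (gcd-GCD m n))
                 (trans a+k≡0 (sym (0%n≡0 m))) (trans b+k≡0 (sym (0%n≡0 n))))
    from : a ≡ b [mod g ] → T (any (isCorner m n) (orbit m n (beam (a , b))))
    from a≡b =
      let k , k<mn , a+k≡0 , b+k≡0 = crt (gcd-GCD m n) a b 0 0 (strip⁻¹ a≡b)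
      in Equivalence.from (any-orbit m n (beam (a , b)) (isCorner m n)) (k , <-≤-trans k<mn m*n≤bound ,
          subst (λ s → T (isCorner m n s)) (sym (iterate-beam k (a , b)))
            (Equivalence.from (corner-beam (a + k) (b + k)) (trans a+k≡0 (0%n≡0 m) , trans b+k≡0 (0%n≡0 n))))

  g∣G : g ∣ G
  g∣G = n∣m*n 2

  corner-diff : ∀ p → T (any (isCorner m n) (orbit m n (beam p))) ⇔ (diff p % g ≡ 0)
  corner-diff (a , b) = ⇔-trans (corners a b) (⇔-sym (⊖-divisible g∣G a b))

  -- A trajectory is labelled by the difference of an unfolded point on it, up to the sign,
  -- which depends on the direction of travel.
  key : Diag → ℕ
  key e = abs (diff (fwd e))

  diff-bwd : ∀ e → InRange e → diff (bwd e) ≡ negate (diff (fwd e))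
  diff-bwd (dg i j β) (i<m , j<n) = ⊖-negate (+-cancelʳ-mod G 1 (begin
    (X.uncell i β + X.uncell i (not β) + 1) % G  ≡⟨ %-congˡ {o = G} (trans (+-comm _ 1) (X.uncell-sum β i<m)) ⟩
    (2 * m) % G                                  ≡⟨ n∣m⇒m%n≡0 (2 * m) G (GCD.gcd∣m GCD[2m,2n,G]) ⟩
    0                                            ≡⟨ n∣m⇒m%n≡0 (2 * n) G (GCD.gcd∣n GCD[2m,2n,G]) ⟨
    (2 * n) % G                                  ≡⟨ %-congˡ {o = G} (trans (+-comm _ 1) (Y.uncell-sum true j<n)) ⟨
    (j + Y.uncell j false + 1) % G               ∎))

  key-bwd : ∀ e → InRange e → abs (diff (bwd e)) ≡ key e
  key-bwd e e∈ = trans (cong abs (diff-bwd e e∈)) (abs-negate (⊖<G _ _))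

  key-meets : ∀ {p} e → InRange e → diff p ≡ diff (fwd e) ⊎ diff p ≡ diff (bwd e) → abs (diff p) ≡ key e
  key-meets e e∈ (inj₁ eq) = cong abs eq
  key-meets e e∈ (inj₂ eq) = trans (cong abs eq) (key-bwd e e∈)

  from-fwd : ∀ (P : State → Bool) d → InRange d →
             T (any P (orbit m n (beam (fwd d)))) → T (any P (trajStates m n d))
  from-fwd P d d∈ t = Equivalence.from (any-++ P (orbit m n (startFwd d)) (orbit m n (startBwd d)))
    (inj₁ (subst (λ s → T (any P (orbit m n s))) (beam-fwd d d∈) t))

  to-fwd-bwd : ∀ (P : State → Bool) d → InRange d → T (any P (trajStates m n d)) →
               T (any P (orbit m n (beam (fwd d)))) ⊎ T (any P (orbit m n (beam (bwd d))))
  to-fwd-bwd P d d∈ t = Data.Sum.map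
    (subst (λ s → T (any P (orbit m n s))) (sym (beam-fwd d d∈)))
    (subst (λ s → T (any P (orbit m n s))) (sym (beam-bwd d d∈)))
    (Equivalence.to (any-++ P (orbit m n (startFwd d)) (orbit m n (startBwd d))) t)

  same-trajectory : ∀ {d e} → InRange d → InRange e → T (sameTraj m n d e) ⇔ (key d ≡ key e)
  same-trajectory {d} {e} d∈ e∈ = mk⇔ to from
    where
    to : T (sameTraj m n d e) → key d ≡ key e
    to t with to-fwd-bwd (Visits e) d d∈ t
    ... | inj₁ t-fwd = key-meets e e∈ (Equivalence.to (meets (fwd d) e e∈) t-fwd)
    ... | inj₂ t-bwd = trans (sym (key-bwd d d∈)) (key-meets e e∈ (Equivalence.to (meets (bwd d) e e∈) t-bwd))
    from : key d ≡ key e → T (sameTraj m n d e)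
    from eq = from-fwd (Visits e) d d∈ (Equivalence.from (meets (fwd d) e e∈)
      (Data.Sum.map₂ (λ eq′ → trans eq′ (sym (diff-bwd e e∈))) (abs-injective (⊖<G _ _) (⊖<G _ _) eq)))

  open-trajectory : ∀ {d} → InRange d → T (isOpen m n d) ⇔ (key d % g ≡ 0)
  open-trajectory {d} d∈ = mk⇔ to from
    where
    to : T (isOpen m n d) → key d % g ≡ 0
    to t with to-fwd-bwd (isCorner m n) d d∈ t
    ... | inj₁ t-fwd = Equivalence.from (abs-divisible g∣G (⊖<G _ _)) (Equivalence.to (corner-diff (fwd d)) t-fwd)
    ... | inj₂ t-bwd = subst (λ x → x % g ≡ 0) (key-bwd d d∈)
                         (Equivalence.from (abs-divisible g∣G (⊖<G _ _)) (Equivalence.to (corner-diff (bwd d)) t-bwd))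
    from : key d % g ≡ 0 → T (isOpen m n d)
    from k≡0 = from-fwd (isCorner m n) d d∈
      (Equivalence.from (corner-diff (fwd d)) (Equivalence.to (abs-divisible g∣G (⊖<G _ _)) k≡0))

  key≤g : ∀ d → key d ≤ g
  key≤g d = *-cancelˡ-≤ 2 (subst (_≤ G) (cong (key d +_) (sym (+-identityʳ (key d)))) (abs-half (⊖<G _ _)))

  key-witness : ∀ {k} → k < g → InRange (dg k 0 true) × key (dg k 0 true) ≡ k
  key-witness {k} k<g = (<-≤-trans k<g (∣⇒≤ (GCD.gcd∣m (gcd-GCD m n))) , >-nonZero⁻¹ n) , (begin
    abs (k ⊖ 0)  ≡⟨ cong abs (⊖-identityʳ (<-≤-trans k<g (m≤m+n g (g + 0)))) ⟩
    abs k        ≡⟨ abs-fixed (+-mono-≤ (<⇒≤ k<g) (≤-trans (<⇒≤ k<g) (m≤m+n g 0))) ⟩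
    k            ∎)

  diags-InRange : All InRange (diags m n)
  diags-InRange = All.tabulate λ d∈ →
    let i , i∈ , d∈ᵢ = find (∈-concatMap⁻ _ {xs = upTo m} d∈)
        j , j∈ , d∈ᵢⱼ = find (∈-concatMap⁻ _ {xs = upTo n} d∈ᵢ)
    in in-cell (∈-upTo⁻ i∈) (∈-upTo⁻ j∈) d∈ᵢⱼ
    where
    in-cell : ∀ {i j d} → i < m → j < n → d ∈ dg i j true ∷ dg i j false ∷ [] → InRange d
    in-cell i<m j<n (here refl)         = i<m , j<n
    in-cell i<m j<n (there (here refl)) = i<m , j<n

  hits-witness : ∀ {k} → k < g → T (any (λ e → key e ≡ᵇ k) (diags m n))
  hits-witness {k} k<g = any⁺ _ (lose
    (∈-concatMap⁺ _ (lose (∈-upTo⁺ (proj₁ (proj₁ (key-witness k<g))))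
      (∈-concatMap⁺ _ (lose (∈-upTo⁺ (>-nonZero⁻¹ n)) (here refl)))))
    (≡⇒≡ᵇ _ _ (proj₂ (key-witness k<g))))

  open Counting {m} {n} InRange key (λ k → k % g ≡ᵇ 0) (suc g) same-trajectory
    (λ {d} d∈ → T-injective (⇔-trans (open-trajectory d∈) (mk⇔ (≡⇒≡ᵇ _ 0) (≡ᵇ⇒≡ _ 0))))
    (λ d → s≤s (key≤g d))

  closed-paths : C m n ≡ g ∸ 1
  closed-paths = begin
    C m n                                        ≡⟨ countClasses-keys [] (diags m n) [] diags-InRange ⟩
    sumBelow g newClosedKeys + newClosedKeys g   ≡⟨ cong₂ _+_ (sumBelow-interval g none-at-0 one-below-g) none-at-g ⟩
    g ∸ 1 + 0                                    ≡⟨ +-identityʳ (g ∸ 1) ⟩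
    g ∸ 1                                        ∎
    where
    newClosedKeys : ℕ → ℕ
    newClosedKeys = newClosed [] (diags m n)
    none-at-0 : newClosedKeys 0 ≡ 0
    none-at-0 rewrite 0%n≡0 g {{g-nonZero}} = refl
    none-at-g : newClosedKeys g ≡ 0
    none-at-g rewrite n%n≡0 g {{g-nonZero}} = refl
    one-below-g : ∀ k → 0 < k → k < g → newClosedKeys k ≡ 1
    one-below-g k 0<k k<g rewrite m<n⇒m%n≡m {{g-nonZero}} k<g | dec-false (k ≟ 0) (≢-nonZero⁻¹ k {{>-nonZero 0<k}})
                                | Equivalence.to T-≡ (hits-witness k<g) = refl

C≡gcd∸1 : ∀ m n .{{_ : NonZero m}} .{{_ : NonZero n}} → C m n ≡ gcd m n ∸ 1
C≡gcd∸1 m n = Billiard.closed-paths m n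

gcd[m+n,n]≡gcd[m,n] : ∀ m n → gcd (m + n) n ≡ gcd m n
gcd[m+n,n]≡gcd[m,n] m n = sym (GCD.unique
  (subst (λ x → GCD x n (gcd m n)) (+-comm n m) (GCD.sym (GCD.step (GCD.sym (gcd-GCD m n)))))
  (gcd-GCD (m + n) n))

lemma2p2 : ∀ (m n : ℕ) → 1 ≤ m → 1 ≤ n → (C m n ≡ C n m) × (C m n ≡ C (m + n) n)
lemma2p2 m n 1≤m 1≤n = symmetric , shear
  where
  instance
    m-nonZero : NonZero m
    m-nonZero = >-nonZero 1≤m
    n-nonZero : NonZero n
    n-nonZero = >-nonZero 1≤n
    m+n-nonZero : NonZero (m + n)
    m+n-nonZero = >-nonZero (≤-trans 1≤m (m≤m+n m n))
  symmetric : C m n ≡ C n m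
  symmetric = begin
    C m n          ≡⟨ C≡gcd∸1 m n ⟩
    gcd m n ∸ 1    ≡⟨ cong (_∸ 1) (gcd-comm m n) ⟩
    gcd n m ∸ 1    ≡⟨ C≡gcd∸1 n m ⟨
    C n m          ∎
  shear : C m n ≡ C (m + n) n
  shear = begin
    C m n              ≡⟨ C≡gcd∸1 m n ⟩
    gcd m n ∸ 1        ≡⟨ cong (_∸ 1) (gcd[m+n,n]≡gcd[m,n] m n) ⟨
    gcd (m + n) n ∸ 1  ≡⟨ C≡gcd∸1 (m + n) n ⟨
    C (m + n) n        ∎
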